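{- $\mathrm{CF}(B_7)\le 6$.
   Context: $B_7$ is the rooted complete binary tree with $7$ levels ($127$ vertices). For a graph $G$, a conflict-free coloring w.r.t. paths is a function $C\colon V(G)\to\{1,\dots,c\}$ such that for the vertex set of every path of $G$ (including single vertices) some color occurs exactly once on it; $\mathrm{CF}(G)$ is the minimum such $c$. -}

module Defs where

open import Data.Nat using (ℕ; suc; _+_; _*_; _∸_; _^_)
open import Data.Fin using (Fin; toℕ)
open import Data.Fin.Properties using (_≟_)
open import Data.List using (List; []; _∷_; length; filter)
open import Data.List.Relation.Unary.Linked using (Linked)
open import Data.List.Relation.Unary.Unique.Propositional using (Unique)
open import Data.Product using (Σ; ∃; _×_)
open import Data.Sum using (_⊎_)
open import Relation.Binary.PropositionalEquality using (_≡_; _≢_)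

Graph : ℕ → Set₁
Graph n = Fin n → Fin n → Set

IsPath : ∀ {n} → Graph n → List (Fin n) → Set
IsPath G vs = vs ≢ [] × Unique vs × Linked G vs

ConflictFree : ∀ {n} → Graph n → (c : ℕ) → (Fin n → Fin c) → Set
ConflictFree {n} G c C =
  (vs : List (Fin n)) → IsPath G vs →
  ∃ λ (k : Fin c) → length (filter (λ v → C v ≟ k) vs) ≡ 1

CF≤ : ∀ {n} → Graph n → ℕ → Set
CF≤ {n} G c = Σ (Fin n → Fin c) (ConflictFree G c)

-- Rooted complete binary tree B_k with k levels, 2^k - 1 vertices in heap order:
-- vertex i (0-based) has children 2i+1 and 2i+2.
Child : ∀ {n} → Fin n → Fin n → Set
Child i j = toℕ j ≡ 2 * toℕ i + 1 ⊎ toℕ j ≡ 2 * toℕ i + 2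

B : (k : ℕ) → Graph (2 ^ k ∸ 1)
B k i j = Child i j ⊎ Child j i

-- A path of a tree is determined by its two end vertices, so B₇ has only 8128 paths.
-- An explicit 6-colouring is checked on all of them by a depth-first search from every
-- vertex, whose soundness holds for any graph and any property of paths.
module Submission where

open import Defs
open import Data.Bool using (Bool; true; false; T; _∧_; _∨_)
open import Data.Bool.Properties using (T-∧; T-≡)
open import Data.Bool.ListAction using (all; any)
open import Data.Fin using (Fin; toℕ; fromℕ<; #_)
open import Data.Fin.Properties using (_≟_; toℕ<n; fromℕ<-toℕ)
open import Data.List using (List; []; _∷_; _++_; length; filter; map; allFin)
open import Data.List.Properties using (length-map)
open import Data.List.Membership.Propositional using (_∈_; _∉_)
open import Data.List.Membership.Propositional.Properties using (∈-++⁺ˡ; ∈-++⁺ʳ; ∈-allFin)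
import Data.List.Membership.DecPropositional as DecMembership
import Data.List.Relation.Unary.All as All
open import Data.List.Relation.Unary.All.Properties using (all⁺)
open import Data.List.Relation.Unary.Any using (here; satisfied)
open import Data.List.Relation.Unary.Any.Properties using (any⁻)
open import Data.List.Relation.Unary.AllPairs using (_∷_)
open import Data.List.Relation.Unary.Linked using (_∷_)
open import Data.List.Relation.Unary.Unique.Propositional.Properties using (Unique[x∷xs]⇒x∉xs)
open import Data.Nat using (ℕ; zero; suc; _+_; _*_; _∸_; _^_; _≡ᵇ_; _<?_; ⌊_/2⌋)
open import Data.Nat.Properties using (≡ᵇ⇒≡; +-identityʳ; +-suc; +-comm; m+n∸n≡m; n≡⌊n+n/2⌋; n≡⌈n+n/2⌉)
open import Data.Product using (∃; _,_; proj₁; proj₂)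
open import Data.Sum using (inj₁; inj₂)
open import Data.Vec using (lookup; replicate; concat)
  renaming (_++_ to _++ᵛ_)
open import Function using (_∘_; Equivalence)
open import Relation.Nullary using (does; yes; no; contradiction)
open import Relation.Unary using (Pred; Decidable)
open import Relation.Binary.PropositionalEquality using (_≡_; refl; sym; trans; cong; module ≡-Reasoning)

module PathSearch {n : ℕ} (neighbours : Fin n → List (Fin n)) (P : List (Fin n) → Bool) where

  open DecMembership (_≟_ {n}) using (_∈?_)

  -- True iff every path obtained from v ∷ vs by prepending fresh vertices satisfies P
  -- and has at most fuel vertices in front of vs.
  extensionsSatisfy : ℕ → Fin n → List (Fin n) → Bool
  extensionsSatisfy zero       v vs = false
  extensionsSatisfy (suc fuel) v vs =
    P (v ∷ vs) ∧ all (λ u → does (u ∈? v ∷ vs) ∨ extensionsSatisfy fuel u (v ∷ vs)) (neighbours v)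

  allPathsSatisfy : ℕ → Bool
  allPathsSatisfy fuel = all (λ v → extensionsSatisfy fuel v []) (allFin n)

  extensionsSatisfy⇒P : ∀ fuel v vs → T (extensionsSatisfy fuel v vs) → T (P (v ∷ vs))
  extensionsSatisfy⇒P (suc fuel) v vs ok = proj₁ (Equivalence.to T-∧ ok)

  extensionsSatisfy-extend : ∀ fuel v vs {u} → T (extensionsSatisfy fuel v vs) →
                             u ∈ neighbours v → u ∉ v ∷ vs →
                             ∃ λ fuel′ → T (extensionsSatisfy fuel′ u (v ∷ vs))
  extensionsSatisfy-extend (suc fuel) v vs ok u∈ u∉ =
    fuel , ∉-∨ u∉ (All.lookup (all⁺ _ (neighbours v) (proj₂ (Equivalence.to T-∧ ok))) u∈)
    where
    ∉-∨ : ∀ {u vs b} → u ∉ vs → T (does (u ∈? vs) ∨ b) → T b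
    ∉-∨ {u} {vs} u∉ visited-or-b with u ∈? vs
    ... | yes u∈vs = contradiction u∈vs u∉
    ... | no  _    = visited-or-b

  module _ (G : Graph n) (neighbours-complete : ∀ {u v} → G u v → u ∈ neighbours v) where

    allPathsSatisfy⇒extensionsSatisfy : ∀ fuel → T (allPathsSatisfy fuel) →
                                        ∀ v vs → IsPath G (v ∷ vs) →
                                        ∃ λ fuel′ → T (extensionsSatisfy fuel′ v vs)
    allPathsSatisfy⇒extensionsSatisfy fuel ok v [] _ =
      fuel , All.lookup (all⁺ _ (allFin n) ok) (∈-allFin v)
    allPathsSatisfy⇒extensionsSatisfy fuel ok u (v ∷ vs) (_ , unique@(_ ∷ unique′) , uv ∷ linked)
      with allPathsSatisfy⇒extensionsSatisfy fuel ok v vs ((λ ()) , unique′ , linked)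
    ... | fuel′ , okv =
      extensionsSatisfy-extend fuel′ v vs okv (neighbours-complete uv) (Unique[x∷xs]⇒x∉xs unique)

    allPathsSatisfy-sound : ∀ fuel → T (allPathsSatisfy fuel) → ∀ vs → IsPath G vs → T (P vs)
    allPathsSatisfy-sound fuel ok []       (nonempty , _) = contradiction refl nonempty
    allPathsSatisfy-sound fuel ok (v ∷ vs) path with allPathsSatisfy⇒extensionsSatisfy fuel ok v vs path
    ... | fuel′ , okv = extensionsSatisfy⇒P fuel′ v vs okv

map-filter : ∀ {a b p} {A : Set a} {B : Set b} {P : Pred B p} (P? : Decidable P) (f : A → B) xs →
             map f (filter (P? ∘ f) xs) ≡ filter P? (map f xs)
map-filter P? f []       = refl
map-filter P? f (x ∷ xs) with does (P? (f x))
... | true  = cong (f x ∷_) (map-filter P? f xs)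
... | false = map-filter P? f xs

hasUniqueElement : ∀ {c} → List (Fin c) → Bool
hasUniqueElement {c} ks = any (λ k → length (filter (_≟ k) ks) ≡ᵇ 1) (allFin c)

hasUniqueElement-sound : ∀ {c} (ks : List (Fin c)) → T (hasUniqueElement ks) →
                         ∃ λ k → length (filter (_≟ k) ks) ≡ 1
hasUniqueElement-sound {c} ks ok with satisfied (any⁻ _ (allFin c) ok)
... | k , unique = k , ≡ᵇ⇒≡ _ 1 unique

module _ {n c : ℕ} (C : Fin n → Fin c) where

  -- Counting in map C vs, rather than filtering vs by C v ≟ k, lets the evaluator
  -- compute each colour once instead of once per k.
  hasUniqueColour : List (Fin n) → Bool
  hasUniqueColour vs = hasUniqueElement (map C vs)

  hasUniqueColour-sound : ∀ vs → T (hasUniqueColour vs) →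
                          ∃ λ k → length (filter (λ v → C v ≟ k) vs) ≡ 1
  hasUniqueColour-sound vs ok with hasUniqueElement-sound (map C vs) ok
  ... | k , unique = k , (begin
    length (filter (λ v → C v ≟ k) vs)         ≡⟨ sym (length-map C (filter (λ v → C v ≟ k) vs)) ⟩
    length (map C (filter (λ v → C v ≟ k) vs)) ≡⟨ cong length (map-filter (_≟ k) C vs) ⟩
    length (filter (_≟ k) (map C vs))          ≡⟨ unique ⟩
    1                                          ∎)
    where open ≡-Reasoning

-- The search is required to return true rather than to satisfy T: Agda checks refl
-- against the former much faster than tt against the latter.
conflictFree-bySearch : ∀ {n c} (G : Graph n) (neighbours : Fin n → List (Fin n)) →
                        (∀ {u v} → G u v → u ∈ neighbours v) →
                        (C : Fin n → Fin c) (fuel : ℕ) →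
                        PathSearch.allPathsSatisfy neighbours (hasUniqueColour C) fuel ≡ true →
                        ConflictFree G c C
conflictFree-bySearch G neighbours neighbours-complete C fuel succeeds vs path =
  hasUniqueColour-sound C vs
    (PathSearch.allPathsSatisfy-sound neighbours (hasUniqueColour C) G neighbours-complete fuel
      (Equivalence.from T-≡ succeeds) vs path)

toℕ⁻¹ : ∀ {n} → ℕ → List (Fin n)
toℕ⁻¹ {n} m with m <? n
... | yes m<n = fromℕ< m<n ∷ []
... | no  _   = []

∈-toℕ⁻¹ : ∀ {n m} (i : Fin n) → toℕ i ≡ m → i ∈ toℕ⁻¹ m
∈-toℕ⁻¹ {n} i refl with toℕ i <? n
... | yes i<n = here (sym (fromℕ<-toℕ i i<n))
... | no  i≮n = contradiction (toℕ<n i) i≮n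

parentIndex : ℕ → ℕ
parentIndex j = ⌊ j ∸ 1 /2⌋

parentIndex-left : ∀ i → parentIndex (2 * i + 1) ≡ i
parentIndex-left i = begin
  ⌊ 2 * i + 1 ∸ 1 /2⌋ ≡⟨ cong ⌊_/2⌋ (m+n∸n≡m (2 * i) 1) ⟩
  ⌊ i + (i + 0) /2⌋   ≡⟨ cong (λ m → ⌊ i + m /2⌋) (+-identityʳ i) ⟩
  ⌊ i + i /2⌋         ≡⟨ sym (n≡⌊n+n/2⌋ i) ⟩
  i                   ∎
  where open ≡-Reasoning

parentIndex-right : ∀ i → parentIndex (2 * i + 2) ≡ i
parentIndex-right i = begin
  ⌊ 2 * i + 2 ∸ 1 /2⌋     ≡⟨ cong (λ m → ⌊ m ∸ 1 /2⌋) (+-suc (2 * i) 1) ⟩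
  ⌊ 2 * i + 1 /2⌋         ≡⟨ cong ⌊_/2⌋ (+-comm (2 * i) 1) ⟩
  ⌊ suc (i + (i + 0)) /2⌋ ≡⟨ cong (λ m → ⌊ suc (i + m) /2⌋) (+-identityʳ i) ⟩
  ⌊ suc (i + i) /2⌋       ≡⟨ sym (n≡⌈n+n/2⌉ i) ⟩
  i                       ∎
  where open ≡-Reasoning

-- The parent index of the root is 0, so the root is listed as its own neighbour;
-- this is harmless because the search only needs a superset of the neighbours.
heapNeighbours : ∀ {n} → Fin n → List (Fin n)
heapNeighbours v =
  toℕ⁻¹ (2 * toℕ v + 1) ++ toℕ⁻¹ (2 * toℕ v + 2) ++ toℕ⁻¹ (parentIndex (toℕ v))

child∈heapNeighbours : ∀ {n} {u v : Fin n} → Child v u → u ∈ heapNeighbours v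
child∈heapNeighbours {u = u}         (inj₁ u≡) = ∈-++⁺ˡ (∈-toℕ⁻¹ u u≡)
child∈heapNeighbours {u = u} {v = v} (inj₂ u≡) =
  ∈-++⁺ʳ (toℕ⁻¹ (2 * toℕ v + 1)) (∈-++⁺ˡ (∈-toℕ⁻¹ u u≡))

parent∈heapNeighbours : ∀ {n} {u v : Fin n} → Child u v → u ∈ heapNeighbours v
parent∈heapNeighbours {u = u} {v = v} v-child =
  ∈-++⁺ʳ (toℕ⁻¹ (2 * toℕ v + 1)) (∈-++⁺ʳ (toℕ⁻¹ (2 * toℕ v + 2))
    (∈-toℕ⁻¹ u (sym (parentIndex-child v-child))))
  where
  parentIndex-child : Child u v → parentIndex (toℕ v) ≡ toℕ u
  parentIndex-child (inj₁ v≡) = trans (cong parentIndex v≡) (parentIndex-left (toℕ u))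
  parentIndex-child (inj₂ v≡) = trans (cong parentIndex v≡) (parentIndex-right (toℕ u))

heapNeighbours-complete : ∀ {k} {u v : Fin (2 ^ k ∸ 1)} → B k u v → u ∈ heapNeighbours v
heapNeighbours-complete {v = v} (inj₁ u-parent) = parent∈heapNeighbours {v = v} u-parent
heapNeighbours-complete {v = v} (inj₂ u-child)  = child∈heapNeighbours {v = v} u-child

-- One block per level of B₇ in heap order.
colouring : Fin (2 ^ 7 ∸ 1) → Fin 6
colouring = lookup
  (   replicate 1 (# 5)
  ++ᵛ replicate 2 (# 0)
  ++ᵛ replicate 4 (# 1)
  ++ᵛ replicate 8 (# 2)
  ++ᵛ concat (replicate 2 (replicate 4 (# 3) ++ᵛ replicate 4 (# 4)))
  ++ᵛ concat (replicate 2 (replicate 4 (# 0) ++ᵛ replicate 4 (# 4) ++ᵛ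
                           replicate 4 (# 0) ++ᵛ replicate 4 (# 3)))
  ++ᵛ replicate 64 (# 1) )

-- A longest path of B₇ joins two leaves through the root: 13 vertices.
claim3 : CF≤ (B 7) 6
claim3 = colouring ,
  conflictFree-bySearch (B 7) heapNeighbours (heapNeighbours-complete {7}) colouring 13 refl
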